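{- Let $\mathbb{B}=\langle\mathbf{B},\mathbf{I}\rangle$ be a Bochvar system, let $\mathbf{A}_{\mathbb{B}}$ be its associated Bochvar algebra, and let $\mathbb{B}_{\mathbf{A}_{\mathbb{B}}}$ be the Bochvar system associated with $\mathbf{A}_{\mathbb{B}}$. Then $\mathbb{B}$ is isomorphic to $\mathbb{B}_{\mathbf{A}_{\mathbb{B}}}$.
   Context: A Bochvar system is a pair $\langle\mathbf{B},\mathbf{I}\rangle$ with $\mathbf{B}$ a Boolean algebra and $\mathbf{I}=\langle I,\wedge,1\rangle$ a meet-subsemilattice with unit of $\mathbf{B}$. Two Bochvar systems $\langle\mathbf{B}_1,\mathbf{I}_1\rangle,\langle\mathbf{B}_2,\mathbf{I}_2\rangle$ are isomorphic if there is a Boolean isomorphism $g:\mathbf{B}_1\to\mathbf{B}_2$ with $g(i)\in I_2$ for all $i\in I_1$. Bochvar algebras: $\mathbf{WK}^e$ is the algebra on $\{0,\tfrac12,1\}$ of type $\langle\wedge,\vee,\neg,J_2,0,1\rangle$ with $\neg0=1,\neg\tfrac12=\tfrac12,\neg1=0$, $\vee,\wedge$ Boolean on $\{0,1\}$ and outputting $\tfrac12$ whenever an argument is $\tfrac12$, $J_21=1$, $J_2\tfrac12=J_20=0$; Bochvar algebras form $ISP(\mathbf{WK}^e)$. Their involutive bisemilattice reducts are Płonka sums of semilattice direct systems of Boolean algebras $\{\mathbf{A}_i\}_{i\in I}$ over lower-bounded join-semilattices $\langle I,\vee,i_0\rangle$. Associated Bochvar algebra $\mathbf{A}_{\mathbb{B}}$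 of $\langle\mathbf{B},\mathbf{I}\rangle$: the unique Bochvar algebra whose involutive bisemilattice reduct is the Płonka sum of fibres $\mathbf{B}/[i)$ ($[i)$ the principal filter generated by $i\in I$), over $I$ ordered by $i\le j$ iff $j\le_{\mathbf{B}}i$ (least element $1$), with maps $p_{ij}(a/[i))=a/[j)$. Associated Bochvar system of a Bochvar algebra $\mathbf{A}$: $\langle\mathbf{A}_{i_0},\mathbf{K}\rangle$ with $\mathbf{A}_{i_0}$ the bottom fibre and $K=\{J_2(1^{\mathbf{A}_i}):i\in I\}$, $1^{\mathbf{A}_i}$ the top of fibre $\mathbf{A}_i$. -}

module Defs where

open import Level using (Level; _⊔_; suc)
open import Data.Product using (Σ; ∃; _×_; _,_; proj₁; proj₂)
open import Relation.Binary.Core using (Rel)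
open import Algebra.Lattice.Bundles using (BooleanAlgebra)
import Algebra.Lattice.Properties.Lattice as LatticeProps

record BochvarSystem (c ℓ ℓ' : Level) : Set (suc (c ⊔ ℓ ⊔ ℓ')) where
  field
    B : BooleanAlgebra c ℓ
  open BooleanAlgebra B public
  field
    I        : Carrier → Set ℓ'
    I-resp   : ∀ {x y} → x ≈ y → I x → I y
    I-⊤      : I ⊤
    I-∧      : ∀ {x y} → I x → I y → I (x ∧ y)

-- Algebras of type ⟨∧,∨,¬,0,1⟩ over a setoid (just the operations),
-- used for Boolean isomorphisms between a Boolean algebra and a fibre.

record BoolOps (c ℓ : Level) : Set (suc (c ⊔ ℓ)) where
  field
    Carrier : Set c
    _≈_     : Rel Carrier ℓ
    _∧_ _∨_ : Carrier → Carrier → Carrier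
    ¬_      : Carrier → Carrier
    𝟘 𝟙     : Carrier

boolOps : ∀ {c ℓ} → BooleanAlgebra c ℓ → BoolOps c ℓ
boolOps B = record
  { Carrier = Carrier ; _≈_ = _≈_ ; _∧_ = _∧_ ; _∨_ = _∨_ ; ¬_ = ¬_
  ; 𝟘 = ⊥ ; 𝟙 = ⊤ }
  where open BooleanAlgebra B

record IsBoolIso {c₁ ℓ₁ c₂ ℓ₂} (X : BoolOps c₁ ℓ₁) (Y : BoolOps c₂ ℓ₂)
                 (g : BoolOps.Carrier X → BoolOps.Carrier Y)
                 : Set (c₁ ⊔ ℓ₁ ⊔ c₂ ⊔ ℓ₂) where
  private
    module X = BoolOps X
    module Y = BoolOps Y
  field
    cong       : ∀ {a b} → a X.≈ b → g a Y.≈ g b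
    injective  : ∀ {a b} → g a Y.≈ g b → a X.≈ b
    surjective : ∀ y → Σ X.Carrier (λ a → g a Y.≈ y)
    hom-∧      : ∀ a b → g (a X.∧ b) Y.≈ (g a Y.∧ g b)
    hom-∨      : ∀ a b → g (a X.∨ b) Y.≈ (g a Y.∨ g b)
    hom-¬      : ∀ a → g (X.¬ a) Y.≈ (Y.¬ g a)
    hom-𝟘      : g X.𝟘 Y.≈ Y.𝟘
    hom-𝟙      : g X.𝟙 Y.≈ Y.𝟙

-- Its involutive bisemilattice reduct is the Płonka sum of the fibres
-- B/[i) (i ∈ I) over I ordered by i ≤ j iff j ≤_B i (so the join of i, j
-- is i ∧ j and the least index is ⊤), with p_ij(a/[i)) = a/[j).
-- An element a/[i) of fibre i is represented by the pair (i , a);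
-- a/[i) = b/[i) iff a ∧ i ≈ b ∧ i.  Płonka-sum operations:
--   (i,a) ∧ (j,b) = (i∧j , a∧b),  (i,a) ∨ (j,b) = (i∧j , a∨b),
--   ¬ (i,a) = (i , ¬a),  0 = (⊤,⊥),  1 = (⊤,⊤)  (constants in bottom fibre),
-- and the (unique) Bochvar operation J₂ sends a/[i) to (a∧i)/[⊤) in
-- the bottom fibre.

module Associated {c ℓ ℓ'} (𝔹 : BochvarSystem c ℓ ℓ') where
  open BochvarSystem 𝔹
  open LatticeProps lattice using (∧-idem)

  Index : Set (c ⊔ ℓ')
  Index = Σ Carrier I

  Elem : Set (c ⊔ ℓ')
  Elem = Index × Carrier

  index : Elem → Carrier
  index ((i , _) , _) = i

  _≈A_ : Elem → Elem → Set ℓ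
  ((i , _) , a) ≈A ((j , _) , b) = (i ≈ j) × ((a ∧ i) ≈ (b ∧ j))

  _∧A_ : Elem → Elem → Elem
  ((i , p) , a) ∧A ((j , q) , b) = ((i ∧ j , I-∧ p q) , a ∧ b)

  _∨A_ : Elem → Elem → Elem
  ((i , p) , a) ∨A ((j , q) , b) = ((i ∧ j , I-∧ p q) , a ∨ b)

  ¬A_ : Elem → Elem
  ¬A ((i , p) , a) = ((i , p) , ¬ a)

  0A 1A : Elem
  0A = ((⊤ , I-⊤) , ⊥)
  1A = ((⊤ , I-⊤) , ⊤)

  J₂ : Elem → Elem
  J₂ ((i , p) , a) = ((⊤ , I-⊤) , a ∧ i)

  top : Index → Elem
  top ι = (ι , ⊤)

  -- The Bochvar system associated with A_𝔹 : ⟨ bottom fibre , K ⟩.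

  BottomElem : Set (c ⊔ ℓ' ⊔ ℓ)
  BottomElem = Σ Elem (λ x → index x ≈ ⊤)

  bottomFibre : BoolOps (c ⊔ ℓ' ⊔ ℓ) ℓ
  bottomFibre = record
    { Carrier = BottomElem
    ; _≈_ = λ x y → proj₁ x ≈A proj₁ y
    ; _∧_ = λ x y → (proj₁ x ∧A proj₁ y
                    , trans (∧-cong (proj₂ x) (proj₂ y)) (∧-idem ⊤))
    ; _∨_ = λ x y → (proj₁ x ∨A proj₁ y
                    , trans (∧-cong (proj₂ x) (proj₂ y)) (∧-idem ⊤))
    ; ¬_  = λ x → (¬A proj₁ x , proj₂ x)
    ; 𝟘   = (0A , refl)
    ; 𝟙   = (1A , refl)
    }

  K : BottomElem → Set (c ⊔ ℓ' ⊔ ℓ)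
  K x = Σ Index (λ ι → proj₁ x ≈A J₂ (top ι))

BochvarSystem≅AssociatedOfAssociated :
  ∀ {c ℓ ℓ'} → BochvarSystem c ℓ ℓ' → Set (c ⊔ ℓ ⊔ ℓ')
BochvarSystem≅AssociatedOfAssociated 𝔹 =
  Σ (BochvarSystem.Carrier 𝔹 → BoolOps.Carrier bottomFibre) λ g →
    IsBoolIso (boolOps (BochvarSystem.B 𝔹)) bottomFibre g
    × (∀ i → BochvarSystem.I 𝔹 i → K (g i))
  where open Associated 𝔹

-- The bottom fibre of A_𝔹 is B/[⊤) and [⊤) = {⊤}, so a ↦ a/[⊤) is a Boolean
-- isomorphism B ≅ B/[⊤). It sends i ∈ I to J₂(1^{A_i}) = (⊤ ∧ i)/[⊤) = i/[⊤),
-- since J₂ moves the top i/[i) of fibre i to the bottom fibre.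
module Submission where

open import Defs
open import Data.Product using (_,_)
import Algebra.Lattice.Properties.BooleanAlgebra as BooleanAlgebraProperties
import Algebra.Lattice.Properties.Lattice as LatticeProperties

module _ {c ℓ ℓ'} (𝔹 : BochvarSystem c ℓ ℓ') where
  open BochvarSystem 𝔹
  open Associated 𝔹
  open BooleanAlgebraProperties B using (∧-identityˡ; ∧-identityʳ)
  open LatticeProperties lattice using (∧-idem)

  ≈A-fromRepresentatives : ∀ {i j a b} (p : I i) (q : I j) →
                           i ≈ j → a ≈ b → ((i , p) , a) ≈A ((j , q) , b)
  ≈A-fromRepresentatives _ _ i≈j a≈b = i≈j , ∧-cong a≈b i≈j

  embedBottom : Carrier → BottomElem
  embedBottom a = ((⊤ , I-⊤) , a) , refl

  embedBottom-isBoolIso : IsBoolIso (boolOps B) bottomFibre embedBottom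
  embedBottom-isBoolIso = record
    { cong       = ≈A-fromRepresentatives I-⊤ I-⊤ refl
    ; injective  = λ { (_ , a∧⊤≈b∧⊤) →
                       trans (sym (∧-identityʳ _)) (trans a∧⊤≈b∧⊤ (∧-identityʳ _)) }
    ; surjective = λ { (((i , p) , a) , i≈⊤) → a ∧ i , (sym i≈⊤ , ∧-identityʳ _) }
    ; hom-∧      = λ _ _ → ⊤-fibre-closed
    ; hom-∨      = λ _ _ → ⊤-fibre-closed
    ; hom-¬      = λ _ → ≈A-fromRepresentatives I-⊤ I-⊤ refl refl
    ; hom-𝟘      = ≈A-fromRepresentatives I-⊤ I-⊤ refl refl
    ; hom-𝟙      = ≈A-fromRepresentatives I-⊤ I-⊤ refl refl
    }
    where
    ⊤-fibre-closed : ∀ {a} → ((⊤ , I-⊤) , a) ≈A ((⊤ ∧ ⊤ , I-∧ I-⊤ I-⊤) , a)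
    ⊤-fibre-closed = ≈A-fromRepresentatives I-⊤ (I-∧ I-⊤ I-⊤) (sym (∧-idem ⊤)) refl

  embedBottom-I⊆K : ∀ i → I i → K (embedBottom i)
  embedBottom-I⊆K i p =
    (i , p) , ≈A-fromRepresentatives I-⊤ I-⊤ refl (sym (∧-identityˡ i))

theorem3p6 : ∀ {c ℓ ℓ'} (𝔹 : BochvarSystem c ℓ ℓ') → BochvarSystem≅AssociatedOfAssociated 𝔹
theorem3p6 𝔹 = embedBottom 𝔹 , embedBottom-isBoolIso 𝔹 , embedBottom-I⊆K 𝔹
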